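{- Let $G=(V,E)$ be a vertex-labeled digraph defined by a directed clique-width $k$-expression $X$, let $a,b\in\{1,\dots,k\}$ with $a\neq b$, and let $V'\subseteq V$ be an acyclic set in $G$. Then $V'$ is acyclic in the digraph defined by $\alpha_{a,b}(X)$ if and only if $(b,a)\notin \mathrm{reach}(V')$.
   Context: A directed clique-width $k$-expression is an expression built with labels $\{1,\dots,k\}$ from the operations: $a(v)$, creating a vertex $v$ with label $a$; $G\oplus H$, disjoint union of labeled digraphs; $\alpha_{a,b}$ ($a\neq b$), adding an arc from every vertex with label $a$ to every vertex with label $b$; $\rho_{a\to b}$, changing every label $a$ into label $b$. A set $V'\subseteq V$ is acyclic in a digraph if the induced subdigraph on $V'$ has no directed cycle. For $V'\subseteq V$ (with respect to the labeled digraph $G$ defined by $X$), $\mathrm{reach}(V')$ is the set of all pairs $(c,d)$ of labels such that there exist $u\in V'$ with label $c$ and $v\in V'$ with label $d$ such that $v$ is reachable from $u$ by a directed path in $G[V']$ (including $v=u$, via the trivial path). -}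

module Defs where

open import Data.Nat using (ℕ)
open import Data.Fin using (Fin)
open import Data.Unit using (⊤; tt)
open import Data.Empty using (⊥)
open import Data.Fin using (_≟_)
open import Relation.Nullary using (yes; no)
open import Data.Sum using (_⊎_; inj₁; inj₂)
open import Data.Product using (_×_; ∃; ∃-syntax)
open import Relation.Nullary using (¬_)
open import Relation.Unary using (Pred)
open import Relation.Binary.PropositionalEquality using (_≡_; _≢_)
open import Relation.Binary.Construct.Closure.ReflexiveTransitive using (Star)
open import Level using (0ℓ)

-- Directed clique-width k-expressions over labels Fin k (= {1,…,k}).
-- Vertex names are irrelevant up to isomorphism; the vertex set of an
-- expression is computed structurally (disjoint union = _⊎_).
data Expr (k : ℕ) : Set where
  vertex : Fin k → Expr k
  _⊕_    : Expr k → Expr k → Expr k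
  α      : (a b : Fin k) → a ≢ b → Expr k → Expr k
  ρ      : (a b : Fin k) → Expr k → Expr k

Vtx : ∀ {k} → Expr k → Set
Vtx (vertex a) = ⊤
Vtx (X ⊕ Y) = Vtx X ⊎ Vtx Y
Vtx (α a b _ X) = Vtx X
Vtx (ρ a b X) = Vtx X

label : ∀ {k} (X : Expr k) → Vtx X → Fin k
label (vertex a) _ = a
label (X ⊕ Y) (inj₁ u) = label X u
label (X ⊕ Y) (inj₂ v) = label Y v
label (α a b _ X) u = label X u
label (ρ a b X) u with label X u ≟ a
... | yes _ = b
... | no _ = label X u

Arc : ∀ {k} (X : Expr k) → Vtx X → Vtx X → Set
Arc (vertex a) _ _ = ⊥
Arc (X ⊕ Y) (inj₁ u) (inj₁ v) = Arc X u v
Arc (X ⊕ Y) (inj₁ u) (inj₂ v) = ⊥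
Arc (X ⊕ Y) (inj₂ u) (inj₁ v) = ⊥
Arc (X ⊕ Y) (inj₂ u) (inj₂ v) = Arc Y u v
Arc (α a b _ X) u v = Arc X u v ⊎ (label X u ≡ a × label X v ≡ b)
Arc (ρ a b X) u v = Arc X u v

InducedArc : ∀ {k} (X : Expr k) (V' : Pred (Vtx X) 0ℓ) → Vtx X → Vtx X → Set
InducedArc X V' u v = V' u × V' v × Arc X u v

Reachable : ∀ {k} (X : Expr k) (V' : Pred (Vtx X) 0ℓ) → Vtx X → Vtx X → Set
Reachable X V' = Star (InducedArc X V')

Acyclic : ∀ {k} (X : Expr k) (V' : Pred (Vtx X) 0ℓ) → Set
Acyclic X V' = ∀ u v → InducedArc X V' u v → ¬ Reachable X V' v u

InReach : ∀ {k} (X : Expr k) (V' : Pred (Vtx X) 0ℓ) → Fin k → Fin k → Set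
InReach X V' c d =
  ∃[ u ] ∃[ v ] (V' u × V' v × label X u ≡ c × label X v ≡ d × Reachable X V' u v)

-- Every arc added by α_{a,b} goes from an a-labelled to a b-labelled vertex.
-- Hence a walk of α_{a,b}(X)[V'] either stays inside X[V'] (acyclic) or
-- first reaches an a-labelled vertex and, after its last new arc, continues
-- from a b-labelled one within X[V']. A cycle through a new arc u → v therefore
-- yields a walk in X[V'] from a b-labelled to an a-labelled vertex, and
-- conversely such a walk w ⇝ z closes into the cycle z → w ⇝ z.
module Submission where

open import Defs
open import Data.Nat using (ℕ)
open import Data.Fin using (Fin)
open import Relation.Nullary using (¬_)
open import Relation.Unary using (Pred)
open import Relation.Binary.PropositionalEquality using (_≢_; _≡_)
open import Function.Base using (id)
open import Function.Bundles using (_⇔_; mk⇔)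
open import Level using (0ℓ)
open import Data.Sum using (_⊎_; inj₁; inj₂)
open import Data.Product using (_×_; _,_; ∃-syntax)
open import Relation.Binary.Core using (Rel)
open import Relation.Binary.Construct.Closure.ReflexiveTransitive
  using (Star; ε; _◅_; _◅◅_; gmap)

module StarUnionComplete {A : Set} (R : Rel A 0ℓ) (P Q : Pred A 0ℓ) where

  R∪P×Q : Rel A 0ℓ
  R∪P×Q x y = R x y ⊎ (P x × Q y)

  ViaPThenQ : Rel A 0ℓ
  ViaPThenQ x y = (∃[ z ] (P z × Star R x z)) × (∃[ w ] (Q w × Star R w y))

  star-∪-split : ∀ {x y} → Star R∪P×Q x y → Star R x y ⊎ ViaPThenQ x y
  star-∪-split ε = inj₁ ε
  star-∪-split (inj₁ e ◅ r) with star-∪-split r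
  ... | inj₁ r′ = inj₁ (e ◅ r′)
  ... | inj₂ ((z , pz , xz) , wy) = inj₂ ((z , pz , e ◅ xz) , wy)
  star-∪-split {x} (inj₂ (px , qy) ◅ r) with star-∪-split r
  ... | inj₁ r′ = inj₂ ((x , px , ε) , (_ , qy , r′))
  ... | inj₂ (_ , wy) = inj₂ ((x , px , ε) , wy)

module _ {k : ℕ} (X : Expr k) (a b : Fin k) (a≢b : a ≢ b) (V' : Pred (Vtx X) 0ℓ) where

  LabelledIn : Fin k → Pred (Vtx X) 0ℓ
  LabelledIn c u = V' u × label X u ≡ c

  open StarUnionComplete (InducedArc X V') (LabelledIn a) (LabelledIn b)

  induced-α-split : ∀ {u v} → InducedArc (α a b a≢b X) V' u v → R∪P×Q u v
  induced-α-split (pu , pv , inj₁ e) = inj₁ (pu , pv , e)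
  induced-α-split (pu , pv , inj₂ (la , lb)) = inj₂ ((pu , la) , (pv , lb))

  reachable-α-split : ∀ {u v} → Reachable (α a b a≢b X) V' u v →
                      Reachable X V' u v ⊎ ViaPThenQ u v
  reachable-α-split r = star-∪-split (gmap id induced-α-split r)

  reachable-α-lift : ∀ {u v} → Reachable X V' u v → Reachable (α a b a≢b X) V' u v
  reachable-α-lift = gmap id λ (pu , pv , e) → pu , pv , inj₁ e

  acyclic-α⇒¬reach-ba : Acyclic (α a b a≢b X) V' → ¬ InReach X V' b a
  acyclic-α⇒¬reach-ba acα (u , v , pu , pv , lu , lv , r) =
    acα v u (pv , pu , inj₂ (lv , lu)) (reachable-α-lift r)

  ¬reach-ba⇒acyclic-α : Acyclic X V' → ¬ InReach X V' b a → Acyclic (α a b a≢b X) V'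
  ¬reach-ba⇒acyclic-α acX ¬ba u v uv vu with induced-α-split uv | reachable-α-split vu
  ... | inj₁ e | inj₁ vu′ = acX u v e vu′
  ... | inj₁ (pu , pv , e) | inj₂ ((z , (pz , lz) , vz) , (w , (pw , lw) , wu)) =
    ¬ba (w , z , pw , pz , lw , lz , wu ◅◅ (pu , pv , e) ◅ vz)
  ... | inj₂ ((pu , la) , (pv , lb)) | inj₁ vu′ = ¬ba (v , u , pv , pu , lb , la , vu′)
  ... | inj₂ ((pu , la) , _) | inj₂ (_ , (w , (pw , lw) , wu)) =
    ¬ba (w , u , pw , pu , lw , la , wu)

lemma4p8 : (k : ℕ) (X : Expr k) (a b : Fin k) (a≢b : a ≢ b) (V' : Pred (Vtx X) 0ℓ) →
    Acyclic X V' →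
    (Acyclic (α a b a≢b X) V' ⇔ (¬ InReach X V' b a))
lemma4p8 k X a b a≢b V' acX =
  mk⇔ (acyclic-α⇒¬reach-ba X a b a≢b V') (¬reach-ba⇒acyclic-α X a b a≢b V' acX)
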